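{- Let $\mathbf{C}$ be a category, let $\rho$ be a PBPO$^+$ rule, and let $G_L\Rightarrow^{\rho}_{(m,\alpha)}G_R$ be a PBPO$^+$ step, with objects and morphisms $G_K$, $g_L:G_K\to G_L$, $u':G_K\to K'$, $u:K\to G_K$, $g_R:G_K\to G_R$, $w:R\to G_R$ as in the definition. Let $K'\xrightarrow{r'}R'\xleftarrow{t_R}R$ be a pushout of the span $R\xleftarrow{r}K\xrightarrow{t_K}K'$. Then there exists a morphism $w':G_R\to R'$ such that $t_R=w'\circ w$ and $K'\xrightarrow{r'}R'\xleftarrow{w'}G_R$ is a pushout of $K'\xleftarrow{u'}G_K\xrightarrow{g_R}G_R$.
   Context: PBPO$^+$ rule $\rho$: objects $L,K,R,L',K'$ and morphisms $l:K\to L$, $r:K\to R$, $t_L:L\to L'$, $t_K:K\to K'$, $l':K'\to L'$ such that $t_L\circ l=l'\circ t_K$ is a pullback. PBPO$^+$ step $G_L\Rightarrow^{\rho}_{(m,\alpha)}G_R$ with $m:L\to G_L$, $\alpha:G_L\to L'$: $\alpha m=t_L$ and $L\xleftarrow{1_L}L\xrightarrow{m}G_L$ is a pullback of $L\xrightarrow{t_L}L'\xleftarrow{\alpha}G_L$; $G_L\xleftarrow{g_L}G_K\xrightarrow{u'}K'$ is a pullback of $G_L\xrightarrow{\alpha}L'\xleftarrow{l'}K'$; $u:K\to G_K$ is the unique morphism with $u'\circ u=t_K$; and $G_K\xrightarrow{g_R}G_R\xleftarrow{w}R$ is a pushout of $G_K\xleftarrow{u}K\xrightarrow{r}R$. 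-}

module Defs where

open import Level using (Level; _⊔_; suc)
open import Data.Product using (Σ; _×_; _,_)
open import Relation.Binary.PropositionalEquality using (_≡_)

record Category (o ℓ : Level) : Set (suc (o ⊔ ℓ)) where
  infixr 9 _∘_
  field
    Obj  : Set o
    Hom  : Obj → Obj → Set ℓ
    id   : ∀ {A} → Hom A A
    _∘_  : ∀ {A B C} → Hom B C → Hom A B → Hom A C
    identityˡ : ∀ {A B} (f : Hom A B) → id ∘ f ≡ f
    identityʳ : ∀ {A B} (f : Hom A B) → f ∘ id ≡ f
    assoc : ∀ {A B C D} (f : Hom A B) (g : Hom B C) (h : Hom C D) →
            (h ∘ g) ∘ f ≡ h ∘ (g ∘ f)

module _ {o ℓ : Level} (𝐂 : Category o ℓ) where
  open Category 𝐂

  ∃! : ∀ {X Y} → (Hom X Y → Set ℓ) → Set ℓ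
  ∃! {X} {Y} P = Σ (Hom X Y) λ h → P h × (∀ h' → P h' → h' ≡ h)

  record IsPullback {A B C P : Obj} (f : Hom A C) (g : Hom B C)
                    (p : Hom P A) (q : Hom P B) : Set (o ⊔ ℓ) where
    field
      commute   : f ∘ p ≡ g ∘ q
      universal : ∀ {X} (h : Hom X A) (k : Hom X B) → f ∘ h ≡ g ∘ k →
                  ∃! (λ (x : Hom X P) → (p ∘ x ≡ h) × (q ∘ x ≡ k))

  record IsPushout {A B C P : Obj} (f : Hom C A) (g : Hom C B)
                   (i₁ : Hom A P) (i₂ : Hom B P) : Set (o ⊔ ℓ) where
    field
      commute   : i₁ ∘ f ≡ i₂ ∘ g
      universal : ∀ {X} (h : Hom A X) (k : Hom B X) → h ∘ f ≡ k ∘ g →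
                  ∃! (λ (x : Hom P X) → (x ∘ i₁ ≡ h) × (x ∘ i₂ ≡ k))

  record PBPORule : Set (o ⊔ ℓ) where
    field
      L R K L' K' : Obj
      l  : Hom K L
      r  : Hom K R
      tL : Hom L L'
      tK : Hom K K'
      l' : Hom K' L'
      pb : IsPullback tL l' l tK

  record PBPOStep (ρ : PBPORule) (GL GR : Obj) : Set (o ⊔ ℓ) where
    open PBPORule ρ
    field
      m    : Hom L GL
      α    : Hom GL L'
      αm   : α ∘ m ≡ tL
      pbm  : IsPullback tL α id m
      GK   : Obj
      gL   : Hom GK GL
      u'   : Hom GK K'
      pbGK : IsPullback α l' gL u'
      u    : Hom K GK
      u'u  : u' ∘ u ≡ tK
      u-unique : ∀ (v : Hom K GK) → u' ∘ v ≡ tK → v ≡ u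
      gR   : Hom GK GR
      w    : Hom R GR
      poGR : IsPushout u r gR w

-- The step contributes the pushout square (u, r; gR, w), and u' ∘ u = tK turns the given
-- pushout of (r, tK) into a pushout of the composite span (r, u' ∘ u). So the statement is
-- the converse pasting law for pushouts: if the left square and the outer rectangle of two
-- adjacent squares are pushouts, so is the right square.
module Submission where

open import Defs
open import Level using (Level)
open import Data.Product using (Σ; _×_; _,_; proj₁; proj₂)
open import Relation.Binary.PropositionalEquality
  using (_≡_; refl; sym; trans; cong; subst; module ≡-Reasoning)

module PushoutProperties {o ℓ : Level} (𝐂 : Category o ℓ) where
  open Category 𝐂
  open ≡-Reasoning

  ∘-extendˡ : ∀ {A B C D X} {f : Hom B D} {g : Hom A B} {h : Hom C D} {k : Hom A C}
              (x : Hom D X) → f ∘ g ≡ h ∘ k → (x ∘ f) ∘ g ≡ (x ∘ h) ∘ k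
  ∘-extendˡ {f = f} {g} {h} {k} x eq = begin
    (x ∘ f) ∘ g ≡⟨ assoc g f x ⟩
    x ∘ (f ∘ g) ≡⟨ cong (x ∘_) eq ⟩
    x ∘ (h ∘ k) ≡⟨ assoc k h x ⟨
    (x ∘ h) ∘ k ∎

  pushout-jointly-epic : ∀ {A B C P X} {f : Hom C A} {g : Hom C B} {i₁ : Hom A P} {i₂ : Hom B P} →
                         IsPushout 𝐂 f g i₁ i₂ → {x y : Hom P X} →
                         x ∘ i₁ ≡ y ∘ i₁ → x ∘ i₂ ≡ y ∘ i₂ → x ≡ y
  pushout-jointly-epic {i₁ = i₁} {i₂} po {x} {y} x∘i₁≡y∘i₁ x∘i₂≡y∘i₂ =
    trans (unique x (x∘i₁≡y∘i₁ , x∘i₂≡y∘i₂)) (sym (unique y (refl , refl)))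
    where
    open IsPushout po
    mediator : ∃! 𝐂 (λ z → (z ∘ i₁ ≡ y ∘ i₁) × (z ∘ i₂ ≡ y ∘ i₂))
    mediator = universal (y ∘ i₁) (y ∘ i₂) (∘-extendˡ y commute)
    unique : ∀ z → (z ∘ i₁ ≡ y ∘ i₁) × (z ∘ i₂ ≡ y ∘ i₂) → z ≡ proj₁ mediator
    unique = proj₂ (proj₂ mediator)

  -- Squares laid out as      K --u--> G --v--> K'
  --                          |r       |gR      |r'
  --                          R --w--> P --w'-> R'
  pushout-unglue : ∀ {K G K' R P R'}
                   {u : Hom K G} {v : Hom G K'} {r : Hom K R}
                   {gR : Hom G P} {w : Hom R P} {r' : Hom K' R'} {tR : Hom R R'} →
                   IsPushout 𝐂 u r gR w → IsPushout 𝐂 r (v ∘ u) tR r' →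
                   Σ (Hom P R') λ w' → (w' ∘ w ≡ tR) × IsPushout 𝐂 v gR r' w'
  pushout-unglue {K' = K'} {P = P} {R' = R'} {u = u} {v} {r} {gR} {w} {r'} {tR} left outer =
    w' , w'∘w≡tR , record { commute = sym w'∘gR≡r'∘v ; universal = universal }
    where
    module Left = IsPushout left
    module Outer = IsPushout outer

    mediator : ∃! 𝐂 (λ z → (z ∘ gR ≡ r' ∘ v) × (z ∘ w ≡ tR))
    mediator = Left.universal (r' ∘ v) tR (begin
      (r' ∘ v) ∘ u ≡⟨ assoc u v r' ⟩
      r' ∘ (v ∘ u) ≡⟨ Outer.commute ⟨
      tR ∘ r       ∎)
    w' : Hom P R'
    w' = proj₁ mediator
    w'∘gR≡r'∘v : w' ∘ gR ≡ r' ∘ v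
    w'∘gR≡r'∘v = proj₁ (proj₁ (proj₂ mediator))
    w'∘w≡tR : w' ∘ w ≡ tR
    w'∘w≡tR = proj₂ (proj₁ (proj₂ mediator))

    universal : ∀ {X} (h : Hom K' X) (k : Hom P X) → h ∘ v ≡ k ∘ gR →
                ∃! 𝐂 (λ (x : Hom R' X) → (x ∘ r' ≡ h) × (x ∘ w' ≡ k))
    universal {X} h k h∘v≡k∘gR = x , (x∘r'≡h , x∘w'≡k) , unique
      where
      cocone : ∃! 𝐂 (λ z → (z ∘ tR ≡ k ∘ w) × (z ∘ r' ≡ h))
      cocone = Outer.universal (k ∘ w) h (begin
        (k ∘ w) ∘ r  ≡⟨ ∘-extendˡ k Left.commute ⟨
        (k ∘ gR) ∘ u ≡⟨ cong (_∘ u) h∘v≡k∘gR ⟨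
        (h ∘ v) ∘ u  ≡⟨ assoc u v h ⟩
        h ∘ (v ∘ u)  ∎)
      x : Hom R' X
      x = proj₁ cocone
      x∘tR≡k∘w : x ∘ tR ≡ k ∘ w
      x∘tR≡k∘w = proj₁ (proj₁ (proj₂ cocone))
      x∘r'≡h : x ∘ r' ≡ h
      x∘r'≡h = proj₂ (proj₁ (proj₂ cocone))

      x∘w'≡k : x ∘ w' ≡ k
      x∘w'≡k = pushout-jointly-epic left
        (begin
          (x ∘ w') ∘ gR ≡⟨ ∘-extendˡ x w'∘gR≡r'∘v ⟩
          (x ∘ r') ∘ v  ≡⟨ cong (_∘ v) x∘r'≡h ⟩
          h ∘ v         ≡⟨ h∘v≡k∘gR ⟩
          k ∘ gR        ∎)
        (begin
          (x ∘ w') ∘ w ≡⟨ assoc w w' x ⟩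
          x ∘ (w' ∘ w) ≡⟨ cong (x ∘_) w'∘w≡tR ⟩
          x ∘ tR       ≡⟨ x∘tR≡k∘w ⟩
          k ∘ w        ∎)

      unique : ∀ y → (y ∘ r' ≡ h) × (y ∘ w' ≡ k) → y ≡ x
      unique y (y∘r'≡h , y∘w'≡k) = proj₂ (proj₂ cocone) y (y∘tR≡k∘w , y∘r'≡h)
        where
        y∘tR≡k∘w : y ∘ tR ≡ k ∘ w
        y∘tR≡k∘w = begin
          y ∘ tR       ≡⟨ cong (y ∘_) w'∘w≡tR ⟨
          y ∘ (w' ∘ w) ≡⟨ assoc w w' y ⟨
          (y ∘ w') ∘ w ≡⟨ cong (_∘ w) y∘w'≡k ⟩
          k ∘ w        ∎

proposition3 : ∀ {o ℓ : Level} (𝐂 : Category o ℓ) (ρ : PBPORule 𝐂)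
    (GL GR : Category.Obj 𝐂) (s : PBPOStep 𝐂 ρ GL GR)
    (R' : Category.Obj 𝐂)
    (r' : Category.Hom 𝐂 (PBPORule.K' ρ) R')
    (tR : Category.Hom 𝐂 (PBPORule.R ρ) R') →
    IsPushout 𝐂 (PBPORule.r ρ) (PBPORule.tK ρ) tR r' →
    Σ (Category.Hom 𝐂 GR R') (λ w' →
    (tR ≡ Category._∘_ 𝐂 w' (PBPOStep.w s))
    × IsPushout 𝐂 (PBPOStep.u' s) (PBPOStep.gR s) r' w')
proposition3 𝐂 ρ GL GR s R' r' tR outer = w' , sym w'∘w≡tR , right
  where
  open Category 𝐂
  open PBPORule ρ
  open PBPOStep s
  open PushoutProperties 𝐂

  outer-along-u : IsPushout 𝐂 r (u' ∘ u) tR r'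
  outer-along-u = subst (λ f → IsPushout 𝐂 r f tR r') (sym u'u) outer

  unglued : Σ (Hom GR R') λ w' → (w' ∘ w ≡ tR) × IsPushout 𝐂 u' gR r' w'
  unglued = pushout-unglue poGR outer-along-u
  w' : Hom GR R'
  w' = proj₁ unglued
  w'∘w≡tR : w' ∘ w ≡ tR
  w'∘w≡tR = proj₁ (proj₂ unglued)
  right : IsPushout 𝐂 u' gR r' w'
  right = proj₂ (proj₂ unglued)
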